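{- Let $\mathbf P=(P,\leq)$ be a poset, $T$ a tolerance on $\mathbf P$, and $a,b\in P$ with $a\leq b$. Then: (i) if $(a,b)\in T$ then $[a,b]^2\subseteq T$, where $[a,b]=\{x\in P\mid a\leq x\leq b\}$; (ii) if $B$ is a block of $T$ which has bottom element $a$ and top element $b$, then $B=[a,b]$.
   Context: For a poset $\mathbf P=(P,\leq)$ and $x,y\in P$, $x\vee y$ and $x\wedge y$ denote the supremum and infimum of $\{x,y\}$ in $\mathbf P$ (when they exist). A tolerance on $\mathbf P$ is a reflexive and symmetric binary relation $T$ on $P$ satisfying: (1) if $(x,y),(z,u)\in T$ and $x\vee z$ and $y\vee u$ exist then $(x\vee z,y\vee u)\in T$; (2) if $(x,y),(z,u)\in T$ and $x\wedge z$ and $y\wedge u$ exist then $(x\wedge z,y\wedge u)\in T$; (3) if $x,y,z\in P$, $(x,y),(y,z)\in T$ and $T\neq P^2$, then there exist $u,v\in P$ with $u\leq x,y,z\leq v$ and $(u,y),(y,v)\in T$; (4) if $(x,y)\in T$ and $T\neq P^2$, then there exists some $(z,u)\in T$ with $z\leq x,y\leq u$ and such that $(v,z),(v,u)\in T$ for all $v\in P$ with $(v,x),(v,y)\in T$. A block of $T$ is a maximal subset $B\subseteq P$ with $B^2\subseteq T$. -}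

module Defs where

open import Level using (Level; _⊔_; suc)
open import Data.Product using (Σ; _×_; _,_)
open import Relation.Nullary using (¬_)
open import Relation.Binary.PropositionalEquality using (_≡_)
open import Relation.Binary.Structures using (IsPartialOrder)

record PosetOn {c} (P : Set c) (ℓ : Level) : Set (c ⊔ suc ℓ) where
  field
    _≤_ : P → P → Set ℓ
    isPartialOrder : IsPartialOrder _≡_ _≤_

module _ {c ℓ} {P : Set c} (𝐏 : PosetOn P ℓ) where
  open PosetOn 𝐏

  IsSup : P → P → P → Set (c ⊔ ℓ)
  IsSup x y s = x ≤ s × y ≤ s × (∀ w → x ≤ w → y ≤ w → s ≤ w)

  IsInf : P → P → P → Set (c ⊔ ℓ)
  IsInf x y i = i ≤ x × i ≤ y × (∀ w → w ≤ x → w ≤ y → w ≤ i)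

  IsFull : ∀ {t} → (P → P → Set t) → Set (c ⊔ t)
  IsFull T = ∀ x y → T x y

  record IsTolerance {t} (T : P → P → Set t) : Set (c ⊔ ℓ ⊔ t) where
    field
      refl  : ∀ x → T x x
      sym   : ∀ x y → T x y → T y x
      join-compat : ∀ x y z u s r → T x y → T z u →
                    IsSup x z s → IsSup y u r → T s r
      meet-compat : ∀ x y z u s r → T x y → T z u →
                    IsInf x z s → IsInf y u r → T s r
      cond3 : ∀ x y z → T x y → T y z → ¬ IsFull T →
              Σ P λ u → Σ P λ v →
                (u ≤ x × u ≤ y × u ≤ z) × (x ≤ v × y ≤ v × z ≤ v) ×
                T u y × T y v
      cond4 : ∀ x y → T x y → ¬ IsFull T →
              Σ P λ z → Σ P λ u →
                T z u × z ≤ x × z ≤ y × x ≤ u × y ≤ u ×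
                (∀ v → T v x → T v y → T v z × T v u)

  Interval : P → P → P → Set ℓ
  Interval a b x = a ≤ x × x ≤ b

  SquareIn : ∀ {b t} → (P → Set b) → (P → P → Set t) → Set (c ⊔ b ⊔ t)
  SquareIn B T = ∀ x y → B x → B y → T x y

  -- block: maximal subset B with B² ⊆ T (maximal among subsets of the same level)
  IsBlock : ∀ {b t} → (P → P → Set t) → (P → Set b) → Set (c ⊔ suc b ⊔ t)
  IsBlock {b} T B = SquareIn B T ×
    (∀ (C : P → Set b) → (∀ x → B x → C x) → SquareIn C T → ∀ x → C x → B x)

  IsBottom : ∀ {b} → (P → Set b) → P → Set (c ⊔ b ⊔ ℓ)
  IsBottom B a = B a × (∀ x → B x → a ≤ x)

  IsTop : ∀ {b} → (P → Set b) → P → Set (c ⊔ b ⊔ ℓ)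
  IsTop B a = B a × (∀ x → B x → x ≤ a)

{-# OPTIONS --safe #-}
module Submission where

-- Compatibility with joins and meets does all the work. For a ≤ x ≤ b, joining
-- (a , b) ∈ T with (x , x) gives (x , b) ∈ T, and meeting (x , b) with (b , y)
-- gives (x , y) ∈ T; so [a , b]² ⊆ T. A block with bottom a and top b contains
-- (a , b), hence lies inside [a , b] while [a , b] is a square in T containing
-- it, and maximality forces equality.

open import Defs
open import Level using (Level; _⊔_; Lift; lift; lower)
open import Data.Product using (_×_; _,_; proj₁; proj₂)
open import Relation.Binary.Structures using (IsPartialOrder)

module _ {c ℓ} {P : Set c} (𝐏 : PosetOn P ℓ) where
  open PosetOn 𝐏
  open IsPartialOrder isPartialOrder using () renaming (refl to ≤-refl)

  sup-of-≤ : ∀ {x y} → x ≤ y → IsSup 𝐏 x y y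
  sup-of-≤ x≤y = x≤y , ≤-refl , λ _ _ y≤w → y≤w

  sup-of-≥ : ∀ {x y} → y ≤ x → IsSup 𝐏 x y x
  sup-of-≥ y≤x = ≤-refl , y≤x , λ _ x≤w _ → x≤w

  inf-of-≤ : ∀ {x y} → x ≤ y → IsInf 𝐏 x y x
  inf-of-≤ x≤y = ≤-refl , x≤y , λ _ w≤x _ → w≤x

  inf-of-≥ : ∀ {x y} → y ≤ x → IsInf 𝐏 x y y
  inf-of-≥ y≤x = y≤x , ≤-refl , λ _ _ w≤y → w≤y

  module _ {t} {T : P → P → Set t} (tol : IsTolerance 𝐏 T) where
    open IsTolerance tol

    interval-related-to-top : ∀ {a b x} → T a b → Interval 𝐏 a b x → T x b
    interval-related-to-top {a} {b} {x} Tab (a≤x , x≤b) =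
      join-compat a b x x x b Tab (refl x) (sup-of-≤ a≤x) (sup-of-≥ x≤b)

    interval-square : ∀ {a b} → T a b → SquareIn 𝐏 (Interval 𝐏 a b) T
    interval-square {a} {b} Tab x y x∈@(_ , x≤b) y∈@(_ , y≤b) =
      meet-compat x b b y x y
        (interval-related-to-top Tab x∈) (sym y b (interval-related-to-top Tab y∈))
        (inf-of-≤ x≤b) (inf-of-≥ y≤b)

    module _ {B : P → Set (c ⊔ ℓ)} {a b : P} (block : IsBlock 𝐏 T B)
             (bottom : IsBottom 𝐏 B a) (top : IsTop 𝐏 B b) where
      block⊆interval : ∀ x → B x → Interval 𝐏 a b x
      block⊆interval x x∈B = proj₂ bottom x x∈B , proj₂ top x x∈B

      -- The interval lives in Set ℓ; it is lifted to the level of B to compete with it.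
      interval⊆block : ∀ x → Interval 𝐏 a b x → B x
      interval⊆block x x∈ =
        proj₂ block (λ y → Lift c (Interval 𝐏 a b y))
          (λ y y∈B → lift (block⊆interval y y∈B))
          (λ y z y∈ z∈ → interval-square Tab y z (lower y∈) (lower z∈))
          x (lift x∈)
        where
        Tab : T a b
        Tab = proj₁ block a b (proj₁ bottom) (proj₁ top)

proposition1 : ∀ {c ℓ t : Level} {P : Set c} (𝐏 : PosetOn P ℓ)
    (T : P → P → Set t) → IsTolerance 𝐏 T →
    ∀ (a b' : P) → PosetOn._≤_ 𝐏 a b' →
      (T a b' → SquareIn 𝐏 (Interval 𝐏 a b') T) ×
      (∀ (B : P → Set (c ⊔ ℓ)) → IsBlock 𝐏 T B → IsBottom 𝐏 B a → IsTop 𝐏 B b' →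
        (∀ x → B x → Interval 𝐏 a b' x) × (∀ x → Interval 𝐏 a b' x → B x))
proposition1 𝐏 T tol a b _ =
  interval-square 𝐏 tol ,
  λ B block bottom top →
    block⊆interval 𝐏 tol block bottom top , interval⊆block 𝐏 tol block bottom top
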